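{- Let $n>2$ and let $k\ge 1$ with $k+1<n$. Then the model $M_n^{k}$ is $k$-bisimilar, but not $(k+1)$-bisimilar, with the model $N_n^{k-1}$.
   Context: Models are over $n$ variables $p_1,\dots,p_n$; a color is a 0/1 tuple $\langle i_1,\dots,i_n\rangle$ ($i_m=1$ iff $p_m$ true), and $1^{a}0^{b}$ denotes $a$ ones followed by $b$ zeros. For $k$ with $k+1<n$: $M_n^{k}$ consists of $k+1$ layers $L_0,\dots,L_k$, each a two-element antichain, plus a root. In layer $L_j$ the "left" element has color $1^{n-j}0^{j}$ and the "right" element has color $1^{n-(j+1)}0^{j+1}$; the root has color $1^{n-k-1}0^{k+1}$. The order: every element of $L_{j'}$ lies below every element of $L_j$ whenever $j'>j$ (layer $L_0$ is on top), elements of the same layer are incomparable, and the root is below everything. $N_n^{k}$ is defined identically (same $k+1$ layers and colors, same order), except that the root has color $1^{n-k-2}0^{k+2}$. A model is $m$-bisimilar to another if there are relations $S_m\subseteq\dots\subseteq S_0$ linking the roots via $S_m$, with $S_0$-related points having equal colors, and for $j<m$: if $wS_{j+1}w'$ and $w\le v$ then $vS_jv'$ for some $v'\ge w'$, and symmetrically. -}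

module Defs where

open import Data.Nat using (ℕ; zero; suc; _+_; _∸_; _<_; _<ᵇ_)
open import Data.Fin using (Fin; toℕ)
import Data.Fin as F
open import Data.Bool using (Bool)
open import Data.Vec using (Vec; tabulate)
open import Data.Unit using (⊤)
open import Data.Empty using (⊥)
open import Data.Sum using (_⊎_)
open import Data.Product using (Σ; _×_; ∃)
open import Relation.Binary.PropositionalEquality using (_≡_)

-- A (finite, rooted) Kripke model over n propositional variables:
-- a carrier of points, an order _≼_, a coloring (valuation as a 0/1 tuple), a root.
record Model (n : ℕ) : Set₁ where
  field
    Pt   : Set
    _≼_  : Pt → Pt → Set
    col  : Pt → Vec Bool n
    root : Pt
open Model public

-- m-bisimilarity as in the paper: relations S_m ⊆ … ⊆ S_0 (indexed by ℕ,
-- only indices 0..m are constrained), S_m links the roots, S_0-related points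
-- have equal colors, and forth/back conditions for every j < m.
Bisimilar : {n : ℕ} → ℕ → Model n → Model n → Set₁
Bisimilar m M N =
  Σ (ℕ → Pt M → Pt N → Set) λ S →
    (∀ j → j < m → ∀ w w' → S (suc j) w w' → S j w w')
  × S m (root M) (root N)
  × (∀ w w' → S 0 w w' → col M w ≡ col N w')
  × (∀ j → j < m → ∀ w w' v → S (suc j) w w' → _≼_ M w v →
       ∃ λ v' → _≼_ N w' v' × S j v v')
  × (∀ j → j < m → ∀ w w' v' → S (suc j) w w' → _≼_ N w' v' →
       ∃ λ v → _≼_ M w v × S j v v')

-- The color 1^a 0^(n-a) (for a ≤ n): position i is true iff i < a.
block : (n a : ℕ) → Vec Bool n
block n a = tabulate (λ (i : Fin n) → toℕ i <ᵇ a)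

-- Points of the layered frame with layers L_0 … L_k (two elements each) plus a root.
data LPt (k : ℕ) : Set where
  lroot : LPt k
  left  : Fin (suc k) → LPt k
  right : Fin (suc k) → LPt k

_⊑_ : {k : ℕ} → LPt k → LPt k → Set
lroot   ⊑ _       = ⊤
left _  ⊑ lroot   = ⊥
right _ ⊑ lroot   = ⊥
left i  ⊑ left j  = i ≡ j ⊎ j F.< i
left i  ⊑ right j = j F.< i
right i ⊑ left j  = j F.< i
right i ⊑ right j = i ≡ j ⊎ j F.< i

layerCol : (n k : ℕ) → Vec Bool n → LPt k → Vec Bool n
layerCol n k rc lroot     = rc
layerCol n k rc (left j)  = block n (n ∸ toℕ j)
layerCol n k rc (right j) = block n (n ∸ suc (toℕ j))

M : (n k : ℕ) → Model n
M n k = record { Pt = LPt k ; _≼_ = _⊑_ ; col = layerCol n k (block n (n ∸ (k + 1))) ; root = lroot }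

N : (n k : ℕ) → Model n
N n k = record { Pt = LPt k ; _≼_ = _⊑_ ; col = layerCol n k (block n (n ∸ (k + 2))) ; root = lroot }

{-# OPTIONS --safe #-}
-- Removing the lowest layer {l, r} of M_n^{k+1} leaves the frame of N_n^k; r has the
-- colour of the root of N_n^k, and l that of the right point of the lowest layer of N_n^k.
-- The (k+1)-bisimulation is the identity on the common part, sends r to the root, and at
-- level j links the left point of layer i+1 of M to the right point of layer i of N
-- when j ≤ i: both have i+1 zeros, and only from the left one can one climb through
-- points with i, i-1, …, 0 zeros, a difference that takes i+1 moves to expose.  Conversely, a level-(t+1) link between a
-- left and a right point with t+1 zeros forces, by moving up from the left point, such a
-- link at level t one layer higher, and none exists at level 0; a (k+2)-bisimulation
-- would start the chain by linking l.
module Submission where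

open import Defs
open import Data.Nat using (ℕ; zero; suc; _<_; _≤_; _∸_; _<ᵇ_; s≤s; s≤s⁻¹)
open import Data.Nat.Properties
  using (<-≤-trans; <⇒≤; ≤-trans; ≤-refl; n≤1+n; n<1+n; <-trans; <-cmp; <⇒≱; m≤n⇒m<n∨m≡n;
         ∸-cancelˡ-≡; m∸n≤m; <ᵇ⇒<; <⇒<ᵇ; +-comm; 0≢1+n; 1+n≢n; suc-injective)
import Data.Nat.Properties as ℕ
open import Data.Fin using (Fin; toℕ; inject₁; fromℕ; fromℕ<)
import Data.Fin as F
open import Data.Fin.Properties
  using (toℕ-inject₁; toℕ-fromℕ; toℕ-fromℕ<; toℕ<n; toℕ-injective; inject₁-injective;
         fromℕ≢inject₁; ≤fromℕ; ≤̄⇒inject₁<)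
open import Data.Fin.Relation.Unary.Top using (view; ‵fromℕ; ‵inject₁)
open import Data.Vec using (lookup)
open import Data.Vec.Properties using (lookup∘tabulate)
open import Data.Bool using (T)
open import Data.Unit using (tt)
open import Data.Empty using (⊥-elim)
import Data.Sum as Sum
open import Data.Sum using (_⊎_; inj₁; inj₂)
open import Data.Product using (_×_; _,_; ∃; ∃₂; proj₁)
open import Function using (flip)
open import Relation.Nullary using (¬_)
open import Relation.Binary.PropositionalEquality
open import Relation.Binary.Definitions using (tri<; tri≈; tri>)

lookup-block : ∀ n a (i : Fin n) → lookup (block n a) i ≡ (toℕ i <ᵇ a)
lookup-block n a = lookup∘tabulate (λ i → toℕ i <ᵇ a)

block-≢ : ∀ {n a b} → a < b → b ≤ n → block n a ≢ block n b
block-≢ {n} {a} {b} a<b b≤n eq = ℕ.<-irrefl refl (<ᵇ⇒< a a (subst T a<ᵇb≡a<ᵇa (<⇒<ᵇ a<b)))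
  where
  i : Fin n
  i = fromℕ< (<-≤-trans a<b b≤n)
  open ≡-Reasoning
  a<ᵇb≡a<ᵇa : (a <ᵇ b) ≡ (a <ᵇ a)
  a<ᵇb≡a<ᵇa = begin
    a <ᵇ b                ≡⟨ cong (_<ᵇ b) (toℕ-fromℕ< _) ⟨
    toℕ i <ᵇ b            ≡⟨ lookup-block n b i ⟨
    lookup (block n b) i  ≡⟨ cong (flip lookup i) eq ⟨
    lookup (block n a) i  ≡⟨ lookup-block n a i ⟩
    toℕ i <ᵇ a            ≡⟨ cong (_<ᵇ a) (toℕ-fromℕ< _) ⟩
    a <ᵇ a                ∎

block-injective : ∀ {n a b} → a ≤ n → b ≤ n → block n a ≡ block n b → a ≡ b
block-injective {a = a} {b} a≤n b≤n eq with <-cmp a b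
... | tri< a<b _ _ = ⊥-elim (block-≢ a<b b≤n eq)
... | tri≈ _ a≡b _ = a≡b
... | tri> _ _ b<a = ⊥-elim (block-≢ b<a a≤n (sym eq))

block-∸-injective : ∀ {n p q} → p ≤ n → q ≤ n → block n (n ∸ p) ≡ block n (n ∸ q) → p ≡ q
block-∸-injective {n} {p} {q} p≤n q≤n eq =
  ∸-cancelˡ-≡ p≤n q≤n (block-injective (m∸n≤m n p) (m∸n≤m n q) eq)

related-colours : ∀ {n m} {A B : Model n} (bis : Bisimilar m A B) →
                  ∀ {j w w'} → j ≤ m → proj₁ bis j w w' → col A w ≡ col B w'
related-colours (_ , _ , _ , colour , _) {zero} _ s = colour _ _ s
related-colours bis@(_ , down , _) {suc j} j<m s =
  related-colours bis (<⇒≤ j<m) (down j j<m _ _ s)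

-- The number of zeros in the colour of a point; r is the depth of the root.
depth : ∀ {k} → ℕ → LPt k → ℕ
depth r lroot     = r
depth r (left i)  = toℕ i
depth r (right i) = suc (toℕ i)

depth-≤ : ∀ {k r} → suc k ≤ r → (w : LPt k) → depth r w ≤ r
depth-≤ k<r lroot     = ≤-refl
depth-≤ k<r (left i)  = <⇒≤ (<-≤-trans (toℕ<n i) k<r)
depth-≤ k<r (right i) = <-≤-trans (toℕ<n i) k<r

col-M : ∀ n k (w : LPt k) → col (M n k) w ≡ block n (n ∸ depth (suc k) w)
col-M n k lroot     = cong (λ d → block n (n ∸ d)) (+-comm k 1)
col-M n k (left i)  = refl
col-M n k (right i) = refl

col-N : ∀ n k (w : LPt k) → col (N n k) w ≡ block n (n ∸ depth (suc (suc k)) w)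
col-N n k lroot     = cong (λ d → block n (n ∸ d)) (+-comm k 2)
col-N n k (left i)  = refl
col-N n k (right i) = refl

fromℕ≮ : ∀ {k} (i : Fin (suc k)) → ¬ fromℕ k F.< i
fromℕ≮ i fromℕ<i = <⇒≱ fromℕ<i (≤fromℕ i)

inject₁<fromℕ : ∀ {k} (i : Fin k) → inject₁ i F.< fromℕ k
inject₁<fromℕ {k} i = subst₂ _<_ (sym (toℕ-inject₁ i)) (sym (toℕ-fromℕ k)) (toℕ<n i)

inject₁-< : ∀ {k} {i j : Fin k} → i F.< j → inject₁ i F.< inject₁ j
inject₁-< {i = i} {j} = subst₂ _<_ (sym (toℕ-inject₁ i)) (sym (toℕ-inject₁ j))

inject₁-<⁻ : ∀ {k} {i j : Fin k} → inject₁ i F.< inject₁ j → i F.< j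
inject₁-<⁻ {i = i} {j} = subst₂ _<_ (toℕ-inject₁ i) (toℕ-inject₁ j)

inject₁<suc⇒≤ : ∀ {k} {i j : Fin k} → inject₁ i F.< F.suc j → toℕ i ≤ toℕ j
inject₁<suc⇒≤ {i = i} i<1+j = subst (_≤ _) (toℕ-inject₁ i) (s≤s⁻¹ i<1+j)

module _ {k : ℕ} where

  inject : LPt k → LPt (suc k)
  inject lroot     = lroot
  inject (left i)  = left (inject₁ i)
  inject (right i) = right (inject₁ i)

  depth-inject : ∀ r (w : LPt k) → depth r (inject w) ≡ depth r w
  depth-inject r lroot     = refl
  depth-inject r (left i)  = toℕ-inject₁ i
  depth-inject r (right i) = cong suc (toℕ-inject₁ i)

  inject-⊑ : ∀ {w v : LPt k} → w ⊑ v → inject w ⊑ inject v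
  inject-⊑ {lroot}              _   = tt
  inject-⊑ {left _}  {left _}  w⊑v = Sum.map (cong inject₁) inject₁-< w⊑v
  inject-⊑ {left _}  {right _} w⊑v = inject₁-< w⊑v
  inject-⊑ {right _} {left _}  w⊑v = inject₁-< w⊑v
  inject-⊑ {right _} {right _} w⊑v = Sum.map (cong inject₁) inject₁-< w⊑v

  inject-⊑⁻ : ∀ {w v : LPt k} → inject w ⊑ inject v → w ⊑ v
  inject-⊑⁻ {lroot}              _   = tt
  inject-⊑⁻ {left _}  {left _}  w⊑v = Sum.map inject₁-injective inject₁-<⁻ w⊑v
  inject-⊑⁻ {left _}  {right _} w⊑v = inject₁-<⁻ w⊑v
  inject-⊑⁻ {right _} {left _}  w⊑v = inject₁-<⁻ w⊑v
  inject-⊑⁻ {right _} {right _} w⊑v = Sum.map inject₁-injective inject₁-<⁻ w⊑v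

  inject-⊑-leftLast : ∀ {w : LPt k} → inject w ⊑ left (fromℕ (suc k)) → w ≡ lroot
  inject-⊑-leftLast {lroot}   _              = refl
  inject-⊑-leftLast {left i}  (inj₁ i≡last)  = ⊥-elim (fromℕ≢inject₁ (sym i≡last))
  inject-⊑-leftLast {left i}  (inj₂ last<i)  = ⊥-elim (fromℕ≮ _ last<i)
  inject-⊑-leftLast {right i} last<i         = ⊥-elim (fromℕ≮ _ last<i)

  inject-⊑-rightLast : ∀ {w : LPt k} → inject w ⊑ right (fromℕ (suc k)) → w ≡ lroot
  inject-⊑-rightLast {lroot}   _              = refl
  inject-⊑-rightLast {left i}  last<i         = ⊥-elim (fromℕ≮ _ last<i)
  inject-⊑-rightLast {right i} (inj₁ i≡last)  = ⊥-elim (fromℕ≢inject₁ (sym i≡last))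
  inject-⊑-rightLast {right i} (inj₂ last<i)  = ⊥-elim (fromℕ≮ _ last<i)

  data InjectView : LPt (suc k) → Set where
    injected  : ∀ w → InjectView (inject w)
    leftLast  : InjectView (left (fromℕ (suc k)))
    rightLast : InjectView (right (fromℕ (suc k)))

  injectView : (v : LPt (suc k)) → InjectView v
  injectView lroot = injected lroot
  injectView (left i) with view i
  ... | ‵fromℕ     = leftLast
  ... | ‵inject₁ j = injected (left j)
  injectView (right i) with view i
  ... | ‵fromℕ     = rightLast
  ... | ‵inject₁ j = injected (right j)

  shift-⊑ : ∀ {i} {v : LPt k} → right i ⊑ v → left (F.suc i) ⊑ inject v
  shift-⊑ {v = left l}  l<i         = inj₂ (≤̄⇒inject₁< (<⇒≤ l<i))
  shift-⊑ {v = right l} (inj₁ refl) = ≤̄⇒inject₁< ≤-refl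
  shift-⊑ {v = right l} (inj₂ l<i)  = ≤̄⇒inject₁< (<⇒≤ l<i)

  shift-⊑⁻ : ∀ {i} {v : LPt k} → left (F.suc i) ⊑ inject v →
             inject v ≡ left (F.suc i) ⊎ right i ⊑ v ⊎ v ≡ left i
  shift-⊑⁻ {v = left l} (inj₁ 1+i≡l) = inj₁ (cong left (sym 1+i≡l))
  shift-⊑⁻ {v = left l} (inj₂ l<1+i) with m≤n⇒m<n∨m≡n (inject₁<suc⇒≤ l<1+i)
  ... | inj₁ l<i = inj₂ (inj₁ l<i)
  ... | inj₂ l≡i = inj₂ (inj₂ (cong left (toℕ-injective l≡i)))
  shift-⊑⁻ {v = right l} l<1+i with m≤n⇒m<n∨m≡n (inject₁<suc⇒≤ l<1+i)
  ... | inj₁ l<i = inj₂ (inj₁ (inj₂ l<i))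
  ... | inj₂ l≡i = inj₂ (inj₁ (inj₁ (sym (toℕ-injective l≡i))))

  data Linked (j : ℕ) : LPt (suc k) → LPt k → Set where
    same  : ∀ w → Linked j (inject w) w
    extra : Linked j (right (fromℕ (suc k))) lroot
    shift : ∀ i → j ≤ toℕ i → Linked j (left (F.suc i)) (right i)

  Linked-down : ∀ {j w w'} → Linked (suc j) w w' → Linked j w w'
  Linked-down (same w)      = same w
  Linked-down extra         = extra
  Linked-down (shift i j<i) = shift i (<⇒≤ j<i)

  Linked-depth : ∀ {j w w'} → Linked j w w' → depth (suc (suc k)) w ≡ depth (suc (suc k)) w'
  Linked-depth (same w)    = depth-inject _ w
  Linked-depth extra       = cong suc (toℕ-fromℕ (suc k))
  Linked-depth (shift i _) = refl

  forth-same : ∀ {j w' v} → j < suc k → InjectView v → inject w' ⊑ v →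
               ∃ λ v' → w' ⊑ v' × Linked j v v'
  forth-same _ (injected u) w⊑u = u , inject-⊑⁻ w⊑u , same u
  forth-same {j} j<1+k leftLast w⊑v with inject-⊑-leftLast w⊑v
  ... | refl = right (fromℕ k) , tt , shift (fromℕ k) (subst (j ≤_) (sym (toℕ-fromℕ k)) (s≤s⁻¹ j<1+k))
  forth-same _ rightLast w⊑v with inject-⊑-rightLast w⊑v
  ... | refl = lroot , tt , extra

  forth-extra : ∀ {j v} → InjectView v → right (fromℕ (suc k)) ⊑ v →
                ∃ λ v' → lroot ⊑ v' × Linked j v v'
  forth-extra (injected u) _         = u , tt , same u
  forth-extra leftLast     last<last = ⊥-elim (ℕ.<-irrefl refl last<last)
  forth-extra rightLast    _         = lroot , tt , extra

  linked-layer-above : ∀ {j} i → suc j ≤ toℕ i →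
                       ∃ λ v' → right i ⊑ v' × Linked j (left (inject₁ i)) v'
  linked-layer-above {j} (F.suc i) (s≤s j≤i) =
    right (inject₁ i) , inj₂ (≤̄⇒inject₁< ≤-refl) ,
    shift (inject₁ i) (subst (j ≤_) (sym (toℕ-inject₁ i)) j≤i)

  forth-shift : ∀ {j i v} → suc j ≤ toℕ i → InjectView v → left (F.suc i) ⊑ v →
                ∃ λ v' → right i ⊑ v' × Linked j v v'
  forth-shift {j} {i} j<i (injected u) w⊑u with shift-⊑⁻ w⊑u
  ... | inj₁ u≡w         = right i , inj₁ refl , subst (λ x → Linked j x (right i)) (sym u≡w) (shift i (<⇒≤ j<i))
  ... | inj₂ (inj₁ i⊑u)  = u , i⊑u , same u
  ... | inj₂ (inj₂ refl) = linked-layer-above i j<i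
  forth-shift j<i leftLast  (inj₁ refl)    = right _ , inj₁ refl , shift _ (<⇒≤ j<i)
  forth-shift j<i leftLast  (inj₂ last<w)  = ⊥-elim (fromℕ≮ _ last<w)
  forth-shift j<i rightLast last<w         = ⊥-elim (fromℕ≮ _ last<w)

  Linked-forth : ∀ {j w w' v} → j < suc k → Linked (suc j) w w' → w ⊑ v →
                 ∃ λ v' → w' ⊑ v' × Linked j v v'
  Linked-forth j<1+k (same _)      = forth-same j<1+k (injectView _)
  Linked-forth _     extra         = forth-extra (injectView _)
  Linked-forth _     (shift _ j<i) = forth-shift j<i (injectView _)

  Linked-back : ∀ {j w w' v'} → Linked (suc j) w w' → w' ⊑ v' →
                ∃ λ v → w ⊑ v × Linked j v v'
  Linked-back {v' = v'}      (same _)    w'⊑v' = inject v' , inject-⊑ w'⊑v' , same v'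
  Linked-back {v' = lroot}   extra       _     = right (fromℕ (suc k)) , inj₁ refl , extra
  Linked-back {v' = left l}  extra       _     = left (inject₁ l) , inject₁<fromℕ l , same (left l)
  Linked-back {v' = right l} extra       _     = right (inject₁ l) , inj₂ (inject₁<fromℕ l) , same (right l)
  Linked-back {v' = v'}      (shift _ _) i⊑v'  = inject v' , shift-⊑ i⊑v' , same v'

M-bisimilar-N : ∀ n k → Bisimilar (suc k) (M n (suc k)) (N n k)
M-bisimilar-N n k =
  Linked , (λ _ _ _ _ → Linked-down) , same lroot , linked-colours ,
  (λ _ j<1+k _ _ _ → Linked-forth j<1+k) , (λ _ _ _ _ _ → Linked-back)
  where
  open ≡-Reasoning
  linked-colours : ∀ w w' → Linked 0 w w' → col (M n (suc k)) w ≡ col (N n k) w'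
  linked-colours w w' linked = begin
    col (M n (suc k)) w                   ≡⟨ col-M n (suc k) w ⟩
    block n (n ∸ depth (suc (suc k)) w)   ≡⟨ cong (λ d → block n (n ∸ d)) (Linked-depth linked) ⟩
    block n (n ∸ depth (suc (suc k)) w')  ≡⟨ col-N n k w' ⟨
    col (N n k) w'                        ∎

module _ {k₁ k₂ m r₁ r₂ : ℕ} (S : ℕ → LPt k₁ → LPt k₂ → Set)
  (same-depth : ∀ {j w w'} → j ≤ m → S j w w' → depth r₁ w ≡ depth r₂ w')
  (forth : ∀ j → j < m → ∀ w w' v → S (suc j) w w' → w ⊑ v → ∃ λ v' → w' ⊑ v' × S j v v')
  where

  left-right-link-rises : ∀ {t a b} → t < m → S (suc t) (left a) (right b) →
                          ∃₂ λ a' b' → suc (toℕ b') ≡ toℕ b × S t (left a') (right b')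
  left-right-link-rises {a = F.zero} t<m s = ⊥-elim (0≢1+n (same-depth t<m s))
  left-right-link-rises {t} {F.suc c} t<m s
    with forth t t<m _ _ (left (inject₁ c)) s (inj₂ (≤̄⇒inject₁< ≤-refl))
       | trans (toℕ-inject₁ c) (suc-injective (same-depth t<m s))
  ... | lroot   , ()  , _  | _
  ... | left l  , l<b , s' | c≡b = ⊥-elim (ℕ.<-irrefl (trans (sym (same-depth (<⇒≤ t<m) s')) c≡b) l<b)
  ... | right l , _   , s' | c≡b = inject₁ c , l , trans (sym (same-depth (<⇒≤ t<m) s')) c≡b , s'

  no-left-right-link : ∀ t → t < m → ∀ {a b} → toℕ b ≡ t → ¬ S (suc t) (left a) (right b)
  no-left-right-link zero t<m b≡0 s with left-right-link-rises t<m s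
  ... | _ , _ , 1+b'≡b , _ = 0≢1+n (trans (sym b≡0) (sym 1+b'≡b))
  no-left-right-link (suc t) t<m b≡1+t s with left-right-link-rises t<m s
  ... | _ , _ , 1+b'≡b , s' =
    no-left-right-link t (<-trans (n<1+n t) t<m) (suc-injective (trans 1+b'≡b b≡1+t)) s'

bisimilar-depth : ∀ {n m k} → suc (suc k) < n → (bis : Bisimilar m (M n (suc k)) (N n k)) →
                  ∀ {j w w'} → j ≤ m → proj₁ bis j w w' →
                  depth (suc (suc k)) w ≡ depth (suc (suc k)) w'
bisimilar-depth {n} {k = k} k+2<n bis {w = w} {w'} j≤m s =
  block-∸-injective (bounded (depth-≤ ≤-refl w)) (bounded (depth-≤ (n≤1+n _) w')) (begin
    block n (n ∸ depth (suc (suc k)) w)   ≡⟨ col-M n (suc k) w ⟨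
    col (M n (suc k)) w                   ≡⟨ related-colours bis j≤m s ⟩
    col (N n k) w'                        ≡⟨ col-N n k w' ⟩
    block n (n ∸ depth (suc (suc k)) w')  ∎)
  where
  open ≡-Reasoning
  bounded : ∀ {d} → d ≤ suc (suc k) → d ≤ n
  bounded d≤k+2 = ≤-trans d≤k+2 (<⇒≤ k+2<n)

M-not-bisimilar-N : ∀ {n k} → suc (suc k) < n → ¬ Bisimilar (suc (suc k)) (M n (suc k)) (N n k)
M-not-bisimilar-N {n} {k} k+2<n bis@(S , _ , roots , _ , forth , _) =
  no-link-to-lowest-left (forth (suc k) ≤-refl lroot lroot (left (fromℕ (suc k))) roots tt)
  where
  same-depth : ∀ {j w w'} → j ≤ suc (suc k) → S j w w' → depth (suc (suc k)) w ≡ depth (suc (suc k)) w'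
  same-depth = bisimilar-depth k+2<n bis
  depth-partner : ∀ {v'} → S (suc k) (left (fromℕ (suc k))) v' → suc k ≡ depth (suc (suc k)) v'
  depth-partner s = trans (sym (toℕ-fromℕ (suc k))) (same-depth (n≤1+n _) s)
  no-link-to-lowest-left : ¬ ∃ λ v' → lroot ⊑ v' × S (suc k) (left (fromℕ (suc k))) v'
  no-link-to-lowest-left (lroot   , _ , s) = 1+n≢n (sym (depth-partner s))
  no-link-to-lowest-left (left l  , _ , s) = ℕ.<-irrefl (sym (depth-partner s)) (toℕ<n l)
  no-link-to-lowest-left (right l , _ , s) =
    no-left-right-link S same-depth forth k (<-trans (n<1+n k) (n<1+n (suc k)))
      (sym (suc-injective (depth-partner s))) s

mainTheorem11 : (n k : ℕ) → 2 < n → 1 ≤ k → suc k < n →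
    Bisimilar k (M n k) (N n (k ∸ 1)) × ¬ Bisimilar (suc k) (M n k) (N n (k ∸ 1))
-- 2 < n is implied by the other two hypotheses.
mainTheorem11 n zero    _ () _
mainTheorem11 n (suc k) _ _  k+2<n = M-bisimilar-N n k , M-not-bisimilar-N k+2<n
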